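{- Let $\Omega\geq1$ be an odd integer with $\sigma_{ -1}(\Omega)\leq 4/3$, and define \[C_1(\Omega):=\sum_{d\mid\Omega}\frac1d\left(1-\sum_{\substack{f\mid 2\Omega/d\\ f\geq2}}\frac1f\right).\] Then $0<C_1(\Omega)\leq \tfrac12$.
   Context: $\sigma_{ -1}(q)=\sum_{d\mid q}1/d$, the sum over positive divisors of $q$; all divisor sums are over positive divisors. -}

module Defs where

open import Data.Nat as ℕ using (ℕ; zero; suc)
open import Data.Nat.Divisibility using (_∣_; _∣?_)
open import Data.List using (List; []; _∷_; filter; map; foldr; applyUpTo)
open import Data.Integer using (+_)
open import Data.Rational using (ℚ; _+_; _-_; _*_; _/_; 0ℚ; 1ℚ)
open import Relation.Nullary.Decidable using (¬?)
open import Data.Nat using (_<_; _<?_)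

-- positive divisors of n, listed in increasing order (for n = 0 this is empty,
-- but we only use it at positive n)
divisors : ℕ → List ℕ
divisors n = filter (_∣? n) (applyUpTo suc n)

-- reciprocal 1/d of a natural number (d = 0 is never used: divisors are ≥ 1)
recip : ℕ → ℚ
recip zero    = 0ℚ
recip (suc k) = (+ 1) / suc k

sumℚ : List ℚ → ℚ
sumℚ = foldr _+_ 0ℚ

σ₋₁ : ℕ → ℚ
σ₋₁ q = sumℚ (map recip (divisors q))

sumRecipDivisorsGe2 : ℕ → ℚ
sumRecipDivisorsGe2 m = sumℚ (map recip (filter (1 <?_) (divisors m)))

-- m / d for d ≥ 1 (the case d = 0 never occurs: divisors are ≥ 1)
quot : ℕ → ℕ → ℕ
quot m zero    = 0
quot m (suc k) = m ℕ./ suc k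

C₁ : ℕ → ℚ
C₁ Ω = sumℚ (map (λ d → recip d * (1ℚ - sumRecipDivisorsGe2 (quot (2 ℕ.* Ω) d))) (divisors Ω))

-- For odd q the divisors of 2q are those of q together with their doubles, so σ₋₁(2q) = (3/2)σ₋₁(q).
-- As Σ_{f ∣ m, f ≥ 2} 1/f = σ₋₁(m) − 1, the summand of C₁(Ω) at d ∣ Ω is (1/d)(2 − (3/2)σ₋₁(Ω/d)).
-- Its bracket is ≥ 0 since σ₋₁(Ω/d) ≤ σ₋₁(Ω) ≤ 4/3, and equals 1/2 at d = Ω, whence C₁(Ω) > 0.
-- For d > 1 the bracket is ≤ 1/2 since σ₋₁ ≥ 1, while at d = 1 it is 1/2 − (3/2)(σ₋₁(Ω) − 1);
-- summing, C₁(Ω) ≤ 1/2 − (σ₋₁(Ω) − 1) ≤ 1/2.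
module Submission where

open import Defs
open import Data.Nat as ℕ using (ℕ; zero; suc; _≥_; NonZero; ≢-nonZero; ≢-nonZero⁻¹; >-nonZero)
import Data.Nat.Properties as ℕₚ
open import Data.Nat.Divisibility
  using (_∣_; _∤_; _∣?_; 1∣_; divides; ∣⇒≤; 0∣⇒≡0; ∣-refl; ∣-trans; m∣m*n; n∣m*n; *-monoʳ-∣; *-cancelˡ-∣; m/n∣m)
open import Data.Nat.DivMod using (*-/-assoc; n/1≡n; n/n≡1)
open import Data.Nat.Coprimality using (Coprime; coprime-divisor)
open import Data.Integer using (+_)
open import Data.Rational using (ℚ; _/_; _≤_; _<_; 0ℚ; 1ℚ; ½; _+_; _*_; _-_; nonNegative; toℚᵘ)
open import Data.Rational.Properties
import Data.Rational.Unnormalised as ℚᵘ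
import Data.Rational.Unnormalised.Properties as ℚᵘₚ
open import Data.Rational.Solver using (module +-*-Solver)
open import Data.List using (List; []; _∷_; _++_; map; filter; applyUpTo)
open import Data.List.Properties using (map-∘; filter-accept; filter-reject; filter-all)
open import Data.List.Membership.Propositional using (_∈_)
open import Data.List.Membership.Propositional.Properties
  using (∈-filter⁺; ∈-filter⁻; ∈-applyUpTo⁺; ∈-applyUpTo⁻; ∈-∃++; ∈-++⁺ˡ; ∈-++⁺ʳ; ∈-++⁻; ∈-map⁺; ∈-map⁻)
open import Data.List.Relation.Unary.Any using (here; there)
import Data.List.Relation.Unary.All as All
open import Data.List.Relation.Unary.Unique.Propositional using (Unique; _∷_)
import Data.List.Relation.Unary.Unique.Propositional.Properties as Unique
open import Data.List.Relation.Binary.Subset.Propositional using (_⊆_)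
open import Data.Product using (_×_; _,_; proj₁; proj₂)
open import Data.Sum using (inj₁; inj₂)
open import Function using (_∘_)
open import Relation.Binary.PropositionalEquality
open import Relation.Nullary using (¬_; yes; no; contradiction)

open +-*-Solver

∑ : (ℕ → ℚ) → List ℕ → ℚ
∑ f xs = sumℚ (map f xs)

∑-++ : ∀ f xs ys → ∑ f (xs ++ ys) ≡ ∑ f xs + ∑ f ys
∑-++ f []       ys = sym (+-identityˡ _)
∑-++ f (x ∷ xs) ys = trans (cong (_+_ (f x)) (∑-++ f xs ys)) (sym (+-assoc (f x) _ _))

∑-++-∷ : ∀ f x xs ys → ∑ f (xs ++ x ∷ ys) ≡ f x + ∑ f (xs ++ ys)
∑-++-∷ f x xs ys = begin
  ∑ f (xs ++ x ∷ ys)        ≡⟨ ∑-++ f xs (x ∷ ys) ⟩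
  ∑ f xs + (f x + ∑ f ys)   ≡⟨ solve 3 (λ a b c → a :+ (b :+ c) := b :+ (a :+ c)) refl (∑ f xs) (f x) (∑ f ys) ⟩
  f x + (∑ f xs + ∑ f ys)   ≡⟨ cong (_+_ (f x)) (sym (∑-++ f xs ys)) ⟩
  f x + ∑ f (xs ++ ys)      ∎
  where open ≡-Reasoning

∑-map : ∀ f g xs → ∑ f (map g xs) ≡ ∑ (f ∘ g) xs
∑-map f g xs = cong sumℚ (sym (map-∘ xs))

∑-cong : ∀ {f g} xs → (∀ {x} → x ∈ xs → f x ≡ g x) → ∑ f xs ≡ ∑ g xs
∑-cong []       h = refl
∑-cong (x ∷ xs) h = cong₂ _+_ (h (here refl)) (∑-cong xs (h ∘ there))

∑-*ˡ : ∀ c f xs → ∑ (λ x → c * f x) xs ≡ c * ∑ f xs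
∑-*ˡ c f []       = sym (*-zeroʳ c)
∑-*ˡ c f (x ∷ xs) = trans (cong (_+_ (c * f x)) (∑-*ˡ c f xs)) (sym (*-distribˡ-+ c (f x) _))

∑-mono-≤ : ∀ {f g} xs → (∀ {x} → x ∈ xs → f x ≤ g x) → ∑ f xs ≤ ∑ g xs
∑-mono-≤ []       h = ≤-refl
∑-mono-≤ (x ∷ xs) h = +-mono-≤ (h (here refl)) (∑-mono-≤ xs (h ∘ there))

∑-nonNeg : ∀ {f} xs → (∀ {x} → x ∈ xs → 0ℚ ≤ f x) → 0ℚ ≤ ∑ f xs
∑-nonNeg []       h = ≤-refl
∑-nonNeg (x ∷ xs) h = +-mono-≤ (h (here refl)) (∑-nonNeg xs (h ∘ there))

∑-pos : ∀ {f y} xs → (∀ {x} → x ∈ xs → 0ℚ ≤ f x) → y ∈ xs → 0ℚ < f y → 0ℚ < ∑ f xs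
∑-pos (x ∷ xs) h (here refl) fy>0 = +-mono-<-≤ fy>0 (∑-nonNeg xs (h ∘ there))
∑-pos (x ∷ xs) h (there y∈) fy>0 = +-mono-≤-< (h (here refl)) (∑-pos xs (h ∘ there) y∈ fy>0)

∑-mono-⊆ : ∀ {f} → (∀ x → 0ℚ ≤ f x) → ∀ {xs ys} → Unique xs → xs ⊆ ys → ∑ f xs ≤ ∑ f ys
∑-mono-⊆ f≥0 {[]} {ys} _ _ = ∑-nonNeg ys (λ {x} _ → f≥0 x)
∑-mono-⊆ {f} f≥0 {x ∷ xs} (x∉xs ∷ xs!) xs⊆ys with as , bs , refl ← ∈-∃++ (xs⊆ys (here refl)) = begin
  f x + ∑ f xs          ≤⟨ +-monoʳ-≤ (f x) (∑-mono-⊆ f≥0 xs! (λ y∈ → drop (xs⊆ys (there y∈)) (All.lookup x∉xs y∈))) ⟩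
  f x + ∑ f (as ++ bs)  ≡⟨ sym (∑-++-∷ f x as bs) ⟩
  ∑ f (as ++ x ∷ bs)    ∎
  where
  open ≤-Reasoning
  drop : ∀ {y} → y ∈ as ++ x ∷ bs → x ≢ y → y ∈ as ++ bs
  drop y∈ x≢y with ∈-++⁻ as y∈
  ... | inj₁ y∈as         = ∈-++⁺ˡ y∈as
  ... | inj₂ (here refl)  = contradiction refl x≢y
  ... | inj₂ (there y∈bs) = ∈-++⁺ʳ as y∈bs

∈-divisors⁺ : ∀ {k n} .{{_ : NonZero n}} → k ∣ n → k ∈ divisors n
∈-divisors⁺ {zero}  {n} k∣n = contradiction (0∣⇒≡0 k∣n) (≢-nonZero⁻¹ n)
∈-divisors⁺ {suc k} {n} k∣n = ∈-filter⁺ (_∣? n) (∈-applyUpTo⁺ suc (∣⇒≤ k∣n)) k∣n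

∈-divisors⁻ : ∀ n {k} → k ∈ divisors n → k ∣ n
∈-divisors⁻ n = proj₂ ∘ ∈-filter⁻ (_∣? n) {xs = applyUpTo suc n}

divisors-unique : ∀ n → Unique (divisors n)
divisors-unique n = Unique.filter⁺ (_∣? n)
  (Unique.applyUpTo⁺₁ suc n (λ i<j _ → ℕₚ.<⇒≢ i<j ∘ ℕₚ.suc-injective))

nontrivialDivisors : ℕ → List ℕ
nontrivialDivisors n = filter (1 ℕ.<?_) (divisors n)

divisors≡1∷nontrivialDivisors : ∀ n .{{_ : NonZero n}} → divisors n ≡ 1 ∷ nontrivialDivisors n
divisors≡1∷nontrivialDivisors (suc m) = begin
  divisors (suc m)                     ≡⟨ divisors≡1∷rest ⟩
  1 ∷ rest                             ≡⟨ cong (1 ∷_) (sym (filter-all (1 ℕ.<?_) {xs = rest} rest>1)) ⟩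
  1 ∷ filter (1 ℕ.<?_) rest            ≡⟨ cong (1 ∷_) (sym (filter-reject (1 ℕ.<?_) {xs = rest} (ℕₚ.<-irrefl refl))) ⟩
  1 ∷ filter (1 ℕ.<?_) (1 ∷ rest)      ≡⟨ cong (λ ds → 1 ∷ filter (1 ℕ.<?_) ds) (sym divisors≡1∷rest) ⟩
  1 ∷ nontrivialDivisors (suc m)       ∎
  where
  open ≡-Reasoning
  rest : List ℕ
  rest = filter (_∣? suc m) (applyUpTo (suc ∘ suc) m)
  divisors≡1∷rest : divisors (suc m) ≡ 1 ∷ rest
  divisors≡1∷rest = filter-accept (_∣? suc m) (1∣ suc m)
  rest>1 : All.All (1 ℕ.<_) rest
  rest>1 = All.tabulate λ d∈ → above1 (proj₁ (∈-filter⁻ (_∣? suc m) {xs = applyUpTo (suc ∘ suc) m} d∈))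
    where
    above1 : ∀ {d} → d ∈ applyUpTo (suc ∘ suc) m → 1 ℕ.< d
    above1 d∈ with _ , _ , refl ← ∈-applyUpTo⁻ (suc ∘ suc) d∈ = ℕ.s<s ℕ.z<s

0≤recip : ∀ d → 0ℚ ≤ recip d
0≤recip zero    = ≤-refl
0≤recip (suc k) = nonNegative⁻¹ _ {{normalize-nonNeg 1 (suc k)}}

0<recip : ∀ d .{{_ : NonZero d}} → 0ℚ < recip d
0<recip (suc k) = positive⁻¹ _ {{normalize-pos 1 (suc k)}}

recip-2* : ∀ d → recip (2 ℕ.* d) ≡ ½ * recip d
recip-2* zero    = refl
recip-2* (suc k) = toℚᵘ-injective (begin
  toℚᵘ (recip (2 ℕ.* suc k))       ≈⟨ toℚᵘ-fromℚᵘ (ℚᵘ.mkℚᵘ (+ 1) (k ℕ.+ 1 ℕ.* suc k)) ⟩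
  ℚᵘ.½ ℚᵘ.* ℚᵘ.mkℚᵘ (+ 1) k        ≈⟨ ℚᵘₚ.*-congˡ {ℚᵘ.½} (ℚᵘₚ.≃-sym (toℚᵘ-fromℚᵘ (ℚᵘ.mkℚᵘ (+ 1) k))) ⟩
  ℚᵘ.½ ℚᵘ.* toℚᵘ (recip (suc k))   ≈⟨ ℚᵘₚ.≃-sym (toℚᵘ-homo-* ½ (recip (suc k))) ⟩
  toℚᵘ (½ * recip (suc k))         ∎)
  where open ℚᵘₚ.≃-Reasoning

σ₋₁≡1+sumRecipDivisorsGe2 : ∀ n .{{_ : NonZero n}} → σ₋₁ n ≡ 1ℚ + sumRecipDivisorsGe2 n
σ₋₁≡1+sumRecipDivisorsGe2 n = cong (∑ recip) (divisors≡1∷nontrivialDivisors n)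

0≤sumRecipDivisorsGe2 : ∀ n → 0ℚ ≤ sumRecipDivisorsGe2 n
0≤sumRecipDivisorsGe2 n = ∑-nonNeg (nontrivialDivisors n) (λ {d} _ → 0≤recip d)

1≤σ₋₁ : ∀ n .{{_ : NonZero n}} → 1ℚ ≤ σ₋₁ n
1≤σ₋₁ n = begin
  1ℚ                          ≡⟨ sym (+-identityʳ 1ℚ) ⟩
  1ℚ + 0ℚ                     ≤⟨ +-monoʳ-≤ 1ℚ (0≤sumRecipDivisorsGe2 n) ⟩
  1ℚ + sumRecipDivisorsGe2 n  ≡⟨ sym (σ₋₁≡1+sumRecipDivisorsGe2 n) ⟩
  σ₋₁ n                       ∎
  where open ≤-Reasoning

σ₋₁-mono-∣ : ∀ {m n} .{{_ : NonZero n}} → m ∣ n → σ₋₁ m ≤ σ₋₁ n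
σ₋₁-mono-∣ {m} m∣n = ∑-mono-⊆ 0≤recip (divisors-unique m)
  (λ d∈ → ∈-divisors⁺ (∣-trans (∈-divisors⁻ m d∈) m∣n))

2∤⇒coprime-2 : ∀ {k} → 2 ∤ k → Coprime k 2
2∤⇒coprime-2 2∤k {0}                 (_ , 0∣2) = contradiction (0∣⇒≡0 0∣2) λ ()
2∤⇒coprime-2 2∤k {1}                 _         = refl
2∤⇒coprime-2 2∤k {2}                 (2∣k , _) = contradiction 2∣k 2∤k
2∤⇒coprime-2 2∤k {suc (suc (suc i))} (_ , i∣2) = contradiction (∣⇒≤ i∣2) λ { (ℕ.s≤s (ℕ.s≤s ())) }

module _ (e : ℕ) .{{_ : NonZero e}} (2∤e : 2 ∤ e) where

  private
    instance
      two-e≢0 : NonZero (2 ℕ.* e)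
      two-e≢0 = ℕₚ.m*n≢0 2 e

    odd-and-even : List ℕ
    odd-and-even = divisors e ++ map (2 ℕ.*_) (divisors e)

    divisors-2*⊆ : divisors (2 ℕ.* e) ⊆ odd-and-even
    divisors-2*⊆ {k} k∈ with 2 ∣? k
    ... | yes (divides j refl) =
      subst (_∈ odd-and-even) (ℕₚ.*-comm 2 j) (∈-++⁺ʳ (divisors e) (∈-map⁺ (2 ℕ.*_) (∈-divisors⁺ j∣e)))
      where
      j∣e : j ∣ e
      j∣e = *-cancelˡ-∣ 2 (subst (_∣ 2 ℕ.* e) (ℕₚ.*-comm j 2) (∈-divisors⁻ (2 ℕ.* e) k∈))
    ... | no 2∤k = ∈-++⁺ˡ (∈-divisors⁺ (coprime-divisor (2∤⇒coprime-2 2∤k) (∈-divisors⁻ (2 ℕ.* e) k∈)))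

    ⊆divisors-2* : odd-and-even ⊆ divisors (2 ℕ.* e)
    ⊆divisors-2* k∈ with ∈-++⁻ (divisors e) k∈
    ... | inj₁ k∈e = ∈-divisors⁺ (∣-trans (∈-divisors⁻ e k∈e) (n∣m*n 2))
    ... | inj₂ k∈2e with j , j∈ , refl ← ∈-map⁻ (2 ℕ.*_) k∈2e = ∈-divisors⁺ (*-monoʳ-∣ 2 (∈-divisors⁻ e j∈))

    odd-and-even-unique : Unique odd-and-even
    odd-and-even-unique = Unique.++⁺ (divisors-unique e)
      (Unique.map⁺ (ℕₚ.*-cancelˡ-≡ _ _ 2) (divisors-unique e)) disjoint
      where
      disjoint : ∀ {k} → ¬ (k ∈ divisors e × k ∈ map (2 ℕ.*_) (divisors e))
      disjoint (k∈ , k∈2e) with j , _ , refl ← ∈-map⁻ (2 ℕ.*_) k∈2e = 2∤e (∣-trans (m∣m*n j) (∈-divisors⁻ e k∈))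

  σ₋₁-2* : σ₋₁ (2 ℕ.* e) ≡ (+ 3 / 2) * σ₋₁ e
  σ₋₁-2* = begin
    σ₋₁ (2 ℕ.* e)                                ≡⟨ ≤-antisym (∑-mono-⊆ 0≤recip (divisors-unique (2 ℕ.* e)) divisors-2*⊆)
                                                               (∑-mono-⊆ 0≤recip odd-and-even-unique ⊆divisors-2*) ⟩
    ∑ recip odd-and-even                          ≡⟨ ∑-++ recip (divisors e) _ ⟩
    σ₋₁ e + ∑ recip (map (2 ℕ.*_) (divisors e))   ≡⟨ cong (_+_ (σ₋₁ e)) (∑-map recip (2 ℕ.*_) (divisors e)) ⟩
    σ₋₁ e + ∑ (recip ∘ (2 ℕ.*_)) (divisors e)     ≡⟨ cong (_+_ (σ₋₁ e)) (∑-cong (divisors e) (λ {d} _ → recip-2* d)) ⟩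
    σ₋₁ e + ∑ (λ d → ½ * recip d) (divisors e)    ≡⟨ cong (_+_ (σ₋₁ e)) (∑-*ˡ ½ recip (divisors e)) ⟩
    σ₋₁ e + ½ * σ₋₁ e                             ≡⟨ solve 1 (λ s → s :+ con ½ :* s := con (+ 3 / 2) :* s) refl (σ₋₁ e) ⟩
    (+ 3 / 2) * σ₋₁ e                             ∎
    where open ≡-Reasoning

quot-*ˡ : ∀ m {n d} → d ∣ n → quot (m ℕ.* n) d ≡ m ℕ.* quot n d
quot-*ˡ m {d = zero}  _   = sym (ℕₚ.*-zeroʳ m)
quot-*ˡ m {d = suc _} d∣n = *-/-assoc m d∣n

quot-self : ∀ n .{{_ : NonZero n}} → quot n n ≡ 1
quot-self (suc m) = n/n≡1 (suc m)

quot∣ : ∀ {n d} .{{_ : NonZero n}} → d ∣ n → quot n d ∣ n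
quot∣ {n} {zero}  d∣n = contradiction (0∣⇒≡0 d∣n) (≢-nonZero⁻¹ n)
quot∣ {d = suc _} d∣n = m/n∣m d∣n

quot-nonZero : ∀ {n d} .{{_ : NonZero n}} → d ∣ n → NonZero (quot n d)
quot-nonZero {n} d∣n = ≢-nonZero λ q≡0 → ≢-nonZero⁻¹ n (0∣⇒≡0 (subst (_∣ n) q≡0 (quot∣ d∣n)))

2ℚ : ℚ
2ℚ = + 2 / 1

1-sumRecipDivisorsGe2≡2-σ₋₁ : ∀ n .{{_ : NonZero n}} → 1ℚ - sumRecipDivisorsGe2 n ≡ 2ℚ - σ₋₁ n
1-sumRecipDivisorsGe2≡2-σ₋₁ n = begin
  1ℚ - s         ≡⟨ solve 1 (λ s → con 1ℚ :- s := con 2ℚ :- (con 1ℚ :+ s)) refl s ⟩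
  2ℚ - (1ℚ + s)  ≡⟨ cong (_-_ 2ℚ) (sym (σ₋₁≡1+sumRecipDivisorsGe2 n)) ⟩
  2ℚ - σ₋₁ n     ∎
  where
  open ≡-Reasoning
  s = sumRecipDivisorsGe2 n

deficit : ℚ → ℚ
deficit s = 2ℚ - (+ 3 / 2) * s

deficit-antimono : ∀ {s t} → s ≤ t → deficit t ≤ deficit s
deficit-antimono s≤t = +-monoʳ-≤ 2ℚ (neg-antimono-≤ (*-monoˡ-≤-nonNeg (+ 3 / 2) s≤t))

C₁-summand : ℕ → ℕ → ℚ
C₁-summand Ω d = recip d * (1ℚ - sumRecipDivisorsGe2 (quot (2 ℕ.* Ω) d))

C₁-summand-odd : ∀ {Ω d} .{{_ : NonZero Ω}} → 2 ∤ Ω → d ∣ Ω →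
                 C₁-summand Ω d ≡ recip d * deficit (σ₋₁ (quot Ω d))
C₁-summand-odd {Ω} {d} 2∤Ω d∣Ω = cong (recip d *_) (begin
  1ℚ - sumRecipDivisorsGe2 (quot (2 ℕ.* Ω) d)  ≡⟨ cong (λ m → 1ℚ - sumRecipDivisorsGe2 m) (quot-*ˡ 2 d∣Ω) ⟩
  1ℚ - sumRecipDivisorsGe2 (2 ℕ.* q)           ≡⟨ 1-sumRecipDivisorsGe2≡2-σ₋₁ (2 ℕ.* q) ⟩
  2ℚ - σ₋₁ (2 ℕ.* q)                           ≡⟨ cong (_-_ 2ℚ) (σ₋₁-2* q (2∤Ω ∘ λ 2∣q → ∣-trans 2∣q (quot∣ d∣Ω))) ⟩
  deficit (σ₋₁ q)                              ∎)
  where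
  open ≡-Reasoning
  q = quot Ω d
  instance
    q≢0 : NonZero q
    q≢0 = quot-nonZero d∣Ω
    2q≢0 : NonZero (2 ℕ.* q)
    2q≢0 = ℕₚ.m*n≢0 2 q

module _ {Ω : ℕ} .{{_ : NonZero Ω}} (2∤Ω : 2 ∤ Ω) where

  C₁-summand-nonNeg : σ₋₁ Ω ≤ + 4 / 3 → ∀ {d} → d ∣ Ω → 0ℚ ≤ C₁-summand Ω d
  C₁-summand-nonNeg σΩ≤4/3 {d} d∣Ω = begin
    0ℚ                                     ≡⟨ sym (*-zeroʳ (recip d)) ⟩
    recip d * deficit (+ 4 / 3)            ≤⟨ *-monoˡ-≤-nonNeg (recip d) {{nonNegative (0≤recip d)}}
                                                (deficit-antimono (≤-trans (σ₋₁-mono-∣ (quot∣ d∣Ω)) σΩ≤4/3)) ⟩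
    recip d * deficit (σ₋₁ (quot Ω d))     ≡⟨ sym (C₁-summand-odd 2∤Ω d∣Ω) ⟩
    C₁-summand Ω d                         ∎
    where open ≤-Reasoning

  C₁-summand≤½*recip : ∀ {d} → d ∣ Ω → C₁-summand Ω d ≤ ½ * recip d
  C₁-summand≤½*recip {d} d∣Ω = begin
    C₁-summand Ω d                         ≡⟨ C₁-summand-odd 2∤Ω d∣Ω ⟩
    recip d * deficit (σ₋₁ (quot Ω d))     ≤⟨ *-monoˡ-≤-nonNeg (recip d) {{nonNegative (0≤recip d)}}
                                                (deficit-antimono (1≤σ₋₁ (quot Ω d) {{quot-nonZero d∣Ω}})) ⟩
    recip d * deficit 1ℚ                   ≡⟨ *-comm (recip d) ½ ⟩
    ½ * recip d                            ∎
    where open ≤-Reasoning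

  0<C₁-summand-Ω : 0ℚ < C₁-summand Ω Ω
  0<C₁-summand-Ω = begin-strict
    0ℚ                                  ≡⟨ sym (*-zeroˡ ½) ⟩
    0ℚ * ½                              <⟨ *-monoˡ-<-pos ½ (0<recip Ω) ⟩
    recip Ω * ½                         ≡⟨ cong (λ q → recip Ω * deficit (σ₋₁ q)) (sym (quot-self Ω)) ⟩
    recip Ω * deficit (σ₋₁ (quot Ω Ω))  ≡⟨ sym (C₁-summand-odd 2∤Ω ∣-refl) ⟩
    C₁-summand Ω Ω                      ∎
    where open ≤-Reasoning

  C₁-summand-1 : C₁-summand Ω 1 ≡ deficit (σ₋₁ Ω)
  C₁-summand-1 = trans (C₁-summand-odd 2∤Ω (1∣ Ω))
                       (trans (*-identityˡ _) (cong (deficit ∘ σ₋₁) (n/1≡n Ω)))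

  0<C₁ : σ₋₁ Ω ≤ + 4 / 3 → 0ℚ < C₁ Ω
  0<C₁ σΩ≤4/3 = ∑-pos (divisors Ω) (C₁-summand-nonNeg σΩ≤4/3 ∘ ∈-divisors⁻ Ω) (∈-divisors⁺ ∣-refl) 0<C₁-summand-Ω

  C₁≤½ : C₁ Ω ≤ ½
  C₁≤½ = begin
    C₁ Ω                                                  ≡⟨ cong (∑ (C₁-summand Ω)) (divisors≡1∷nontrivialDivisors Ω) ⟩
    C₁-summand Ω 1 + ∑ (C₁-summand Ω) (nontrivialDivisors Ω)
      ≤⟨ +-mono-≤ (≤-reflexive C₁-summand-1) (∑-mono-≤ (nontrivialDivisors Ω) (C₁-summand≤½*recip ∘ nontrivial⇒∣)) ⟩
    deficit (σ₋₁ Ω) + ∑ (λ d → ½ * recip d) (nontrivialDivisors Ω)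
      ≡⟨ cong₂ _+_ (cong deficit (σ₋₁≡1+sumRecipDivisorsGe2 Ω)) (∑-*ˡ ½ recip (nontrivialDivisors Ω)) ⟩
    deficit (1ℚ + S) + ½ * S                              ≡⟨ solve 1 (λ S → con 2ℚ :- con (+ 3 / 2) :* (con 1ℚ :+ S) :+ con ½ :* S := con ½ :- S) refl S ⟩
    ½ - S                                                 ≤⟨ +-monoʳ-≤ ½ (neg-antimono-≤ (0≤sumRecipDivisorsGe2 Ω)) ⟩
    ½                                                     ∎
    where
    open ≤-Reasoning
    S = sumRecipDivisorsGe2 Ω
    nontrivial⇒∣ : ∀ {d} → d ∈ nontrivialDivisors Ω → d ∣ Ω
    nontrivial⇒∣ = ∈-divisors⁻ Ω ∘ proj₁ ∘ ∈-filter⁻ (1 ℕ.<?_) {xs = divisors Ω}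

lemma10 : (Ω : ℕ) → Ω ≥ 1 → 2 ∤ Ω → σ₋₁ Ω ≤ (+ 4) / 3 →
    (0ℚ < C₁ Ω) × (C₁ Ω ≤ ½)
lemma10 Ω Ω≥1 2∤Ω σΩ≤4/3 = 0<C₁ 2∤Ω σΩ≤4/3 , C₁≤½ 2∤Ω
  where instance _ = >-nonZero Ω≥1
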